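{- For any positive integers $r,k$, the set $D_{r,k}$ contains at least one non-zero integer.
   Context: For positive integers $v,b,r,k$, a $(v,b,r,k)$-configuration is a connected bipartite graph with $v$ vertices on one side, each of degree $r$, and $b$ vertices on the other side, each of degree $k$, containing no cycle of length $4$. A tuple $(v,b,r,k)$ is configurable if such a configuration exists; by convention the empty graph is also regarded as a configuration, so the tuple with $v=b=0$ is configurable. For positive integers $r,k$ define $$D_{r,k}=\Big\{d\in\mathbb{N}_0 : \Big(d\tfrac{k}{\gcd(r,k)},\, d\tfrac{r}{\gcd(r,k)},\, r,\, k\Big)\text{ is configurable}\Big\}.$$ -}

module Defs where

open import Data.Nat using (ℕ; zero; suc; _*_; _/_; NonZero)
open import Data.Nat.GCD using (gcd; gcd[m,n]≢0)
open import Data.Nat.Base using (≢-nonZero; NonZero; nonZero)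
open import Data.Fin using (Fin)
open import Data.Bool using (Bool; true; false; if_then_else_)
open import Data.List using (List; map)
open import Data.Nat.ListAction using (sum)
open import Data.List using (allFin)
open import Data.Sum using (_⊎_; inj₁; inj₂)
open import Data.Product using (_×_; Σ; ∃-syntax)
open import Data.Empty using (⊥)
open import Relation.Binary.PropositionalEquality using (_≡_)
open import Relation.Nullary using (¬_)
open import Relation.Binary.Construct.Closure.ReflexiveTransitive using (Star)

-- A bipartite graph with v "point" vertices and b "block" vertices,
-- given by its (simple) incidence relation.
Incidence : ℕ → ℕ → Set
Incidence v b = Fin v → Fin b → Bool

pointDeg : ∀ {v b} → Incidence v b → Fin v → ℕ
pointDeg {v} {b} I i = sum (map (λ j → if I i j then 1 else 0) (allFin b))

blockDeg : ∀ {v b} → Incidence v b → Fin b → ℕ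
blockDeg {v} {b} I j = sum (map (λ i → if I i j then 1 else 0) (allFin v))

Vertex : ℕ → ℕ → Set
Vertex v b = Fin v ⊎ Fin b

Adj : ∀ {v b} → Incidence v b → Vertex v b → Vertex v b → Set
Adj I (inj₁ i) (inj₁ i′) = ⊥
Adj I (inj₁ i) (inj₂ j)  = I i j ≡ true
Adj I (inj₂ j) (inj₁ i)  = I i j ≡ true
Adj I (inj₂ j) (inj₂ j′) = ⊥

Connected : ∀ {v b} → Incidence v b → Set
Connected {v} {b} I = (x y : Vertex v b) → Star (Adj I) x y

NoC4 : ∀ {v b} → Incidence v b → Set
NoC4 {v} {b} I =
  (i i′ : Fin v) (j j′ : Fin b) → ¬ i ≡ i′ → ¬ j ≡ j′ →
  ¬ (I i j ≡ true × I i j′ ≡ true × I i′ j ≡ true × I i′ j′ ≡ true)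

record Configuration (v b r k : ℕ) : Set where
  field
    inc       : Incidence v b
    pointReg  : (i : Fin v) → pointDeg inc i ≡ r
    blockReg  : (j : Fin b) → blockDeg inc j ≡ k
    noC4      : NoC4 inc
    connected : Connected inc

-- For v = b = 0 the unique
-- (empty) incidence relation vacuously satisfies everything, matching the
-- convention that the empty graph is a configuration.
Configurable : ℕ → ℕ → ℕ → ℕ → Set
Configurable v b r k = Configuration v b r k

gcdNZ : (r k : ℕ) → .{{NonZero r}} → NonZero (gcd r k)
gcdNZ (suc r) k = ≢-nonZero (gcd[m,n]≢0 (suc r) k (inj₁ (λ ())))

InD : (r k : ℕ) → .{{NonZero r}} → .{{NonZero k}} → ℕ → Set
InD r k d = Configurable (d * ((k / gcd r k) {{gcdNZ r k}})) (d * ((r / gcd r k) {{gcdNZ r k}})) r k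

-- Write k = k′ + 1, r = r′ + 1 and M = k′ r′ + 1.  Take as points the pairs (a , x) with
-- a < k, x ∈ ℤ/M, as blocks the pairs (c , y) with c < r, y ∈ ℤ/M, and let (a , x) lie on
-- (c , y) iff y ≡ a c + x (mod M).  A point meets each of the r columns of blocks exactly once
-- and a block meets each of the k columns of points exactly once.  Two points on two common
-- blocks give (a − a′)(c − c′) ≡ 0 (mod M), impossible for a ≠ a′, c ≠ c′ since then
-- 0 < |a − a′| |c − c′| ≤ k′ r′ < M.  The graph is connected because (0 , x), (1 , x) and
-- (0 , x + 1) are joined through the blocks (0 , x) and (1 , x + 1).  This gives a
-- (kM, rM, r, k)-configuration, i.e. d = gcd(r, k) · M lies in D_{r,k}.
module Submission where

open import Defs
open import Data.Nat using (ℕ; NonZero)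
open import Data.Product using (∃-syntax; _×_)
open import Relation.Binary.PropositionalEquality using (_≢_)

open import Data.Bool using (true; if_then_else_)
open import Data.Bool.Properties using (T-≡)
open import Data.Fin using (Fin; toℕ; fromℕ<)
open import Data.Fin.Properties using (toℕ-fromℕ<; toℕ-injective; toℕ<n)
open import Data.List using (allFin; map; tabulate)
open import Data.List.Properties using (map-tabulate)
open import Data.Nat.Base
  using (zero; suc; pred; _+_; _*_; _≤_; _<_; _≡ᵇ_; z≤n; s≤s; s≤s⁻¹; z<s; >-nonZero; >-nonZero⁻¹; ≢-nonZero⁻¹)
open import Data.Nat.DivMod
open import Data.Nat.Divisibility using (_∣_; n∣m*n)
open import Data.Nat.GCD using (gcd; gcd[m,n]∣m; gcd[m,n]∣n)
open import Data.Nat.ListAction using (sum)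
open import Data.Nat.Properties
open import Data.Nat.Solver using (module +-*-Solver)
open import Data.Product using (_,_)
open import Data.Sum using (_⊎_; inj₁; inj₂)
open import Function using (_∘_; _$_)
open import Function.Bundles using (Equivalence)
open import Relation.Binary.Construct.Closure.ReflexiveTransitive using (Star; ε; _◅◅_; reverse)
open import Relation.Binary.Construct.Closure.ReflexiveTransitive.Properties using (module StarReasoning)
open import Relation.Binary.Definitions using (Sym; tri<; tri≈; tri>)
open import Relation.Binary.PropositionalEquality
  using (_≡_; refl; sym; trans; cong; cong₂; subst; subst₂; module ≡-Reasoning)
open import Relation.Nullary using (contradiction)
open import Relation.Nullary.Decidable using (recompute)

open import Algebra.Properties.CommutativeSemigroup +-commutativeSemigroup using (interchange)
open ≡-Reasoning

∑ : ℕ → (ℕ → ℕ) → ℕ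
∑ zero    f = 0
∑ (suc n) f = f 0 + ∑ n (f ∘ suc)

sum-map-allFin : ∀ n (f : ℕ → ℕ) → sum (map (f ∘ toℕ) (allFin n)) ≡ ∑ n f
sum-map-allFin n f = trans (cong sum (map-tabulate {n = n} (λ i → i) (f ∘ toℕ))) (sum-tabulate n f)
  where
  sum-tabulate : ∀ n (f : ℕ → ℕ) → sum (tabulate {n = n} (f ∘ toℕ)) ≡ ∑ n f
  sum-tabulate zero    f = refl
  sum-tabulate (suc n) f = cong (f 0 +_) (sum-tabulate n (f ∘ suc))

∑-cong : ∀ n {f g : ℕ → ℕ} → (∀ i → i < n → f i ≡ g i) → ∑ n f ≡ ∑ n g
∑-cong zero    f≗g = refl
∑-cong (suc n) f≗g = cong₂ _+_ (f≗g 0 z<s) (∑-cong n (λ i i<n → f≗g (suc i) (s≤s i<n)))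

∑-const : ∀ n c → ∑ n (λ _ → c) ≡ n * c
∑-const zero    c = refl
∑-const (suc n) c = cong (c +_) (∑-const n c)

∑-+ : ∀ m n f → ∑ (m + n) f ≡ ∑ m f + ∑ n (λ i → f (m + i))
∑-+ zero    n f = refl
∑-+ (suc m) n f = trans (cong (f 0 +_) (∑-+ m n (f ∘ suc))) (sym (+-assoc (f 0) _ _))

∑-* : ∀ m n f → ∑ (m * n) f ≡ ∑ m (λ a → ∑ n (λ x → f (a * n + x)))
∑-* zero    n f = refl
∑-* (suc m) n f = begin
  ∑ (n + m * n) f
    ≡⟨ ∑-+ n (m * n) f ⟩
  ∑ n f + ∑ (m * n) (λ i → f (n + i))
    ≡⟨ cong (∑ n f +_) (∑-* m n (λ i → f (n + i))) ⟩
  ∑ n f + ∑ m (λ a → ∑ n (λ x → f (n + (a * n + x))))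
    ≡⟨ cong (∑ n f +_) (∑-cong m λ a _ → ∑-cong n λ x _ → cong f (sym (+-assoc n (a * n) x))) ⟩
  ∑ n f + ∑ m (λ a → ∑ n (λ x → f (suc a * n + x))) ∎

∑-snoc : ∀ n f → ∑ (suc n) f ≡ ∑ n f + f n
∑-snoc zero    f = +-comm (f 0) 0
∑-snoc (suc n) f = trans (cong (f 0 +_) (∑-snoc n (f ∘ suc))) (sym (+-assoc (f 0) _ _))

∑-rotate : ∀ n f → f n ≡ f 0 → ∑ n (f ∘ suc) ≡ ∑ n f
∑-rotate n f fn≡f0 = +-cancelˡ-≡ (f 0) _ _ $ begin
  f 0 + ∑ n (f ∘ suc)  ≡⟨ ∑-snoc n f ⟩
  ∑ n f + f n          ≡⟨ cong (∑ n f +_) fn≡f0 ⟩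
  ∑ n f + f 0          ≡⟨ +-comm (∑ n f) (f 0) ⟩
  f 0 + ∑ n f          ∎

δ : ℕ → ℕ → ℕ
δ m n = if m ≡ᵇ n then 1 else 0

δ-comm : ∀ m n → δ m n ≡ δ n m
δ-comm zero    zero    = refl
δ-comm zero    (suc n) = refl
δ-comm (suc m) zero    = refl
δ-comm (suc m) (suc n) = δ-comm m n

∑-δ : ∀ {n t} → t < n → ∑ n (δ t) ≡ 1
∑-δ {suc n} {zero}  _         = cong suc (trans (∑-const n 0) (*-zeroʳ n))
∑-δ {suc n} {suc t} (s≤s t<n) = ∑-δ t<n

module _ {d : ℕ} .{{_ : NonZero d}} where

  %-cong-+ : ∀ m n o p → m % d ≡ n % d → o % d ≡ p % d → (m + o) % d ≡ (n + p) % d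
  %-cong-+ m n o p m≡n o≡p = begin
    (m + o) % d              ≡⟨ %-distribˡ-+ m o d ⟩
    (m % d + o % d) % d      ≡⟨ cong₂ (λ u w → (u + w) % d) m≡n o≡p ⟩
    (n % d + p % d) % d      ≡⟨ %-distribˡ-+ n p d ⟨
    (n + p) % d              ∎

  -- Adding o (d − 1) turns o + m into a multiple of d plus m.
  +-cancelˡ-% : ∀ o m n → (o + m) % d ≡ (o + n) % d → m % d ≡ n % d
  +-cancelˡ-% o m n o+m≡o+n = begin
    m % d                     ≡⟨ [m+kn]%n≡m%n m o d ⟨
    (m + o * d) % d           ≡⟨ cong (_% d) (regroup m) ⟩
    (o + m + o * pred d) % d  ≡⟨ %-cong-+ (o + m) (o + n) (o * pred d) (o * pred d) o+m≡o+n refl ⟩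
    (o + n + o * pred d) % d  ≡⟨ cong (_% d) (regroup n) ⟨
    (n + o * d) % d           ≡⟨ [m+kn]%n≡m%n n o d ⟩
    n % d                     ∎
    where
    regroup : ∀ m → m + o * d ≡ o + m + o * pred d
    regroup m = begin
      m + o * d              ≡⟨ cong (λ e → m + o * e) (suc-pred d) ⟨
      m + o * suc (pred d)   ≡⟨ cong (m +_) (*-suc o (pred d)) ⟩
      m + (o + o * pred d)   ≡⟨ +-assoc m o _ ⟨
      m + o + o * pred d     ≡⟨ cong (_+ o * pred d) (+-comm m o) ⟩
      o + m + o * pred d     ∎

  %-cong-+-comm : ∀ m n o p → (m + n) % d ≡ (o + p) % d → (n + m) % d ≡ (p + o) % d
  %-cong-+-comm m n o p = subst₂ (λ u w → u % d ≡ w % d) (+-comm m n) (+-comm o p)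

  +-cancelʳ-% : ∀ o m n → (m + o) % d ≡ (n + o) % d → m % d ≡ n % d
  +-cancelʳ-% o m n m+o≡n+o = +-cancelˡ-% o m n (%-cong-+-comm m o n o m+o≡n+o)

  %-injective-< : ∀ {m n} → m < d → n < d → m % d ≡ n % d → m ≡ n
  %-injective-< m<d n<d m≡n = trans (sym (m<n⇒m%n≡m m<d)) (trans m≡n (m<n⇒m%n≡m n<d))

  [m*d+n]%d≡n : ∀ m {n} → n < d → (m * d + n) % d ≡ n
  [m*d+n]%d≡n m {n} n<d = begin
    (m * d + n) % d  ≡⟨ cong (_% d) (+-comm (m * d) n) ⟩
    (n + m * d) % d  ≡⟨ [m+kn]%n≡m%n n m d ⟩
    n % d            ≡⟨ m<n⇒m%n≡m n<d ⟩
    n                ∎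

  [m*d+n]/d≡m : ∀ m {n} → n < d → (m * d + n) / d ≡ m
  [m*d+n]/d≡m m {n} n<d = begin
    (m * d + n) / d    ≡⟨ +-distrib-/-∣ˡ n (n∣m*n m) ⟩
    m * d / d + n / d  ≡⟨ cong₂ _+_ (m*n/n≡m m d) (m<n⇒m/n≡0 n<d) ⟩
    m + 0              ≡⟨ +-identityʳ m ⟩
    m                  ∎

  m*d+n<o*d : ∀ {m n o} → m < o → n < d → m * d + n < o * d
  m*d+n<o*d {m} {n} {o} m<o n<d =
    <-≤-trans (+-monoʳ-< (m * d) n<d) (subst (_≤ o * d) (+-comm d (m * d)) (*-monoˡ-≤ d m<o))

  ∑-divMod : ∀ n (f : ℕ → ℕ → ℕ) → ∑ (n * d) (λ m → f (m / d) (m % d)) ≡ ∑ n (λ a → ∑ d (f a))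
  ∑-divMod n f = trans (∑-* n d _) (∑-cong n λ a _ → ∑-cong d λ x x<d →
    cong₂ f ([m*d+n]/d≡m a x<d) ([m*d+n]%d≡n a x<d))

  ∑-mod-shift : ∀ t (f : ℕ → ℕ) → ∑ d (λ x → f ((t + x) % d)) ≡ ∑ d f
  ∑-mod-shift zero    f = ∑-cong d (λ x x<d → cong f (m<n⇒m%n≡m x<d))
  ∑-mod-shift (suc t) f = begin
    ∑ d (λ x → f ((suc t + x) % d))  ≡⟨ ∑-cong d (λ x _ → cong (f ∘ (_% d)) (sym (+-suc t x))) ⟩
    ∑ d (g ∘ suc)                    ≡⟨ ∑-rotate d g g[d]≡g[0] ⟩
    ∑ d g                            ≡⟨ ∑-mod-shift t f ⟩
    ∑ d f                            ∎
    where
    g : ℕ → ℕ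
    g x = f ((t + x) % d)
    g[d]≡g[0] : g d ≡ g 0
    g[d]≡g[0] = cong f (trans ([m+n]%n≡m%n t d) (cong (_% d) (sym (+-identityʳ t))))

-- The two sides differ by (a′ − a)(c′ − c), which is positive and below the modulus.
cross-terms-incongruent : ∀ {k′ r′ a a′ c c′} → a < a′ → c < c′ → a′ ≤ k′ → c′ ≤ r′ →
                          (a * c + a′ * c′) % suc (k′ * r′) ≢ (a′ * c + a * c′) % suc (k′ * r′)
cross-terms-incongruent {k′} {r′} {a} {c = c} a<a′ c<c′ a′≤k′ c′≤r′ cross
  with α , refl ← m≤n⇒∃[o]m+o≡n a<a′ | γ , refl ← m≤n⇒∃[o]m+o≡n c<c′ =
  contradiction (%-injective-< gap<M z<s (+-cancelˡ-% R gap 0 gap≡0)) λ ()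
  where
  open +-*-Solver
  R gap : ℕ
  R   = suc (a + α) * c + a * suc (c + γ)
  gap = suc α * suc γ
  expand : a * c + suc (a + α) * suc (c + γ) ≡ R + gap
  expand = solve 4 (λ a α c γ →
    a :* c :+ (con 1 :+ a :+ α) :* (con 1 :+ c :+ γ)
      := (con 1 :+ a :+ α) :* c :+ a :* (con 1 :+ c :+ γ) :+ (con 1 :+ α) :* (con 1 :+ γ)) refl a α c γ
  M : ℕ
  M = suc (k′ * r′)
  gap≡0 : (R + gap) % M ≡ (R + 0) % M
  gap≡0 = begin
    (R + gap) % M                              ≡⟨ cong (_% M) expand ⟨
    (a * c + suc (a + α) * suc (c + γ)) % M    ≡⟨ cross ⟩
    (suc (a + α) * c + a * suc (c + γ)) % M    ≡⟨ cong (_% M) (+-identityʳ R) ⟨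
    (R + 0) % M                                ∎
  gap<M : gap < M
  gap<M = s≤s (*-mono-≤ (≤-trans (s≤s (m≤n+m α a)) a′≤k′) (≤-trans (s≤s (m≤n+m γ c)) c′≤r′))

no-rectangle : ∀ {k′ r′ a a′ c c′} → a < suc k′ → a′ < suc k′ → c < suc r′ → c′ < suc r′ →
               (a * c + a′ * c′) % suc (k′ * r′) ≡ (a′ * c + a * c′) % suc (k′ * r′) → a ≡ a′ ⊎ c ≡ c′
no-rectangle {a = a} {a′} {c} {c′} a<k a′<k c<r c′<r cross with <-cmp a a′ | <-cmp c c′
... | tri≈ _ a≡a′ _ | _             = inj₁ a≡a′
... | _             | tri≈ _ c≡c′ _ = inj₂ c≡c′
... | tri< a<a′ _ _ | tri< c<c′ _ _ =
  contradiction cross (cross-terms-incongruent a<a′ c<c′ (s≤s⁻¹ a′<k) (s≤s⁻¹ c′<r))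
... | tri> _ _ a′<a | tri< c<c′ _ _ =
  contradiction (sym cross) (cross-terms-incongruent a′<a c<c′ (s≤s⁻¹ a<k) (s≤s⁻¹ c′<r))
... | tri< a<a′ _ _ | tri> _ _ c′<c =
  contradiction (%-cong-+-comm (a′ * c) (a * c′) (a * c) (a′ * c′) (sym cross))
                (cross-terms-incongruent a<a′ c′<c (s≤s⁻¹ a′<k) (s≤s⁻¹ c<r))
... | tri> _ _ a′<a | tri> _ _ c′<c =
  contradiction (%-cong-+-comm (a * c) (a′ * c′) (a′ * c) (a * c′) cross)
                (cross-terms-incongruent a′<a c′<c (s≤s⁻¹ a<k) (s≤s⁻¹ c<r))

Adj-sym : ∀ {v b} (I : Incidence v b) → Sym (Adj I) (Adj I)
Adj-sym I {inj₁ _} {inj₂ _} i∼j = i∼j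
Adj-sym I {inj₂ _} {inj₁ _} j∼i = j∼i

connected-if-reachable-from : ∀ {v b} (I : Incidence v b) (root : Vertex v b) →
                              (∀ x → Star (Adj I) root x) → Connected I
connected-if-reachable-from I root reach x y = reverse (Adj-sym I) (reach x) ◅◅ reach y

module Construction (k′ r′ : ℕ) where

  k r M : ℕ
  k = suc k′
  r = suc r′
  M = suc (k′ * r′)

  -- An element p of Fin (n * M) encodes the pair (quot p , rem p) ∈ [0, n) × [0, M).
  quot rem : ∀ {N} → Fin N → ℕ
  quot p = toℕ p / M
  rem  p = toℕ p % M

  quot<n : ∀ {n} (p : Fin (n * M)) → quot p < n
  quot<n p = m<n*o⇒m/o<n (toℕ<n p)

  rem<M : ∀ {N} (p : Fin N) → rem p < M
  rem<M p = m%n<n (toℕ p) M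

  quot-rem-injective : ∀ {N} {p q : Fin N} → quot p ≡ quot q → rem p ≡ rem q → p ≡ q
  quot-rem-injective {p = p} {q} quot≡ rem≡ = toℕ-injective $ begin
    toℕ p                  ≡⟨ m≡m%n+[m/n]*n (toℕ p) M ⟩
    rem p + quot p * M     ≡⟨ cong₂ (λ x a → x + a * M) rem≡ quot≡ ⟩
    rem q + quot q * M     ≡⟨ m≡m%n+[m/n]*n (toℕ q) M ⟨
    toℕ q                  ∎

  -- The bounds are irrelevant, so embedded vertices are equal as soon as their coordinates are.
  embed : ∀ {n a x} → .(a < n) → .(x < M) → Fin (n * M)
  embed {n} {a} {x} a<n x<M = fromℕ< (m*d+n<o*d (recompute (a <? n) a<n) (recompute (x <? M) x<M))

  quot-embed : ∀ {n a x} (a<n : a < n) (x<M : x < M) → quot (embed a<n x<M) ≡ a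
  quot-embed {a = a} a<n x<M = trans (cong (_/ M) (toℕ-fromℕ< (m*d+n<o*d a<n x<M))) ([m*d+n]/d≡m a x<M)

  rem-embed : ∀ {n a x} (a<n : a < n) (x<M : x < M) → rem (embed a<n x<M) ≡ x
  rem-embed {a = a} a<n x<M = trans (cong (_% M) (toℕ-fromℕ< (m*d+n<o*d a<n x<M))) ([m*d+n]%d≡n a x<M)

  I : Incidence (k * M) (r * M)
  I p j = (quot p * quot j + rem p) % M ≡ᵇ rem j

  incidence-equation : ∀ p j → I p j ≡ true → (quot p * quot j + rem p) % M ≡ rem j % M
  incidence-equation p j pIj =
    trans (≡ᵇ⇒≡ _ _ (Equivalence.from T-≡ pIj)) (sym (m%n%n≡m%n (toℕ j) M))

  incident : ∀ p j → quot p * quot j + rem p ≡ rem j → I p j ≡ true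
  incident p j eq =
    Equivalence.to T-≡ (≡⇒≡ᵇ _ _ (trans (cong (_% M) eq) (m%n%n≡m%n (toℕ j) M)))

  pointReg : (p : Fin (k * M)) → pointDeg I p ≡ r
  pointReg p = begin
    pointDeg I p
      ≡⟨ sum-map-allFin (r * M) (λ m → δ ((quot p * (m / M) + rem p) % M) (m % M)) ⟩
    ∑ (r * M) (λ m → δ ((quot p * (m / M) + rem p) % M) (m % M))
      ≡⟨ ∑-divMod {d = M} r (λ c → δ ((quot p * c + rem p) % M)) ⟩
    ∑ r (λ c → ∑ M (δ ((quot p * c + rem p) % M)))
      ≡⟨ ∑-cong r (λ c _ → ∑-δ (m%n<n (quot p * c + rem p) M)) ⟩
    ∑ r (λ _ → 1)
      ≡⟨ trans (∑-const r 1) (*-identityʳ r) ⟩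
    r ∎

  blockReg : (j : Fin (r * M)) → blockDeg I j ≡ k
  blockReg j = begin
    blockDeg I j
      ≡⟨ sum-map-allFin (k * M) (λ m → δ ((m / M * quot j + m % M) % M) (rem j)) ⟩
    ∑ (k * M) (λ m → δ ((m / M * quot j + m % M) % M) (rem j))
      ≡⟨ ∑-divMod {d = M} k (λ a x → δ ((a * quot j + x) % M) (rem j)) ⟩
    ∑ k (λ a → ∑ M (λ x → δ ((a * quot j + x) % M) (rem j)))
      ≡⟨ ∑-cong k (λ a _ → ∑-mod-shift {d = M} (a * quot j) (λ x → δ x (rem j))) ⟩
    ∑ k (λ _ → ∑ M (λ x → δ x (rem j)))
      ≡⟨ ∑-cong k (λ _ _ → trans (∑-cong M (λ x _ → δ-comm x (rem j))) (∑-δ (rem<M j))) ⟩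
    ∑ k (λ _ → 1)
      ≡⟨ trans (∑-const k 1) (*-identityʳ k) ⟩
    k ∎

  points-on-common-block : ∀ i i′ j → quot i ≡ quot i′ → I i j ≡ true → I i′ j ≡ true → i ≡ i′
  points-on-common-block i i′ j a≡a′ iIj i′Ij =
    quot-rem-injective a≡a′ $ %-injective-< (rem<M i) (rem<M i′) $
    +-cancelˡ-% (quot i * quot j) (rem i) (rem i′) $ begin
      (quot i * quot j + rem i) % M    ≡⟨ incidence-equation i j iIj ⟩
      rem j % M                        ≡⟨ incidence-equation i′ j i′Ij ⟨
      (quot i′ * quot j + rem i′) % M  ≡⟨ cong (λ a → (a * quot j + rem i′) % M) a≡a′ ⟨
      (quot i * quot j + rem i′) % M   ∎

  blocks-through-common-point : ∀ i j j′ → quot j ≡ quot j′ → I i j ≡ true → I i j′ ≡ true → j ≡ j′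
  blocks-through-common-point i j j′ c≡c′ iIj iIj′ =
    quot-rem-injective c≡c′ $ %-injective-< (rem<M j) (rem<M j′) $ begin
      rem j % M                        ≡⟨ incidence-equation i j iIj ⟨
      (quot i * quot j + rem i) % M    ≡⟨ cong (λ c → (quot i * c + rem i) % M) c≡c′ ⟩
      (quot i * quot j′ + rem i) % M   ≡⟨ incidence-equation i j′ iIj′ ⟩
      rem j′ % M                       ∎

  rectangle-congruence : ∀ i i′ j j′ → I i j ≡ true → I i j′ ≡ true → I i′ j ≡ true → I i′ j′ ≡ true →
    (quot i * quot j + quot i′ * quot j′) % M ≡ (quot i′ * quot j + quot i * quot j′) % M
  rectangle-congruence i i′ j j′ iIj iIj′ i′Ij i′Ij′ =
    +-cancelʳ-% (x + x′) (a * c + a′ * c′) (a′ * c + a * c′) $ begin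
      (a * c + a′ * c′ + (x + x′)) % M
        ≡⟨ cong (_% M) (interchange (a * c) x (a′ * c′) x′) ⟨
      (a * c + x + (a′ * c′ + x′)) % M
        ≡⟨ %-cong-+ (a * c + x) (rem j) (a′ * c′ + x′) (rem j′)
                    (incidence-equation i j iIj) (incidence-equation i′ j′ i′Ij′) ⟩
      (rem j + rem j′) % M
        ≡⟨ %-cong-+ (a′ * c + x′) (rem j) (a * c′ + x) (rem j′)
                    (incidence-equation i′ j i′Ij) (incidence-equation i j′ iIj′) ⟨
      (a′ * c + x′ + (a * c′ + x)) % M
        ≡⟨ cong (_% M) (interchange (a′ * c) x′ (a * c′) x) ⟩
      (a′ * c + a * c′ + (x′ + x)) % M
        ≡⟨ cong (λ z → (a′ * c + a * c′ + z) % M) (+-comm x′ x) ⟩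
      (a′ * c + a * c′ + (x + x′)) % M ∎
    where
    a a′ c c′ x x′ : ℕ
    a  = quot i
    a′ = quot i′
    c  = quot j
    c′ = quot j′
    x  = rem i
    x′ = rem i′

  noC4 : NoC4 I
  noC4 i i′ j j′ i≢i′ j≢j′ (iIj , iIj′ , i′Ij , i′Ij′)
    with no-rectangle (quot<n {k} i) (quot<n {k} i′) (quot<n {r} j) (quot<n {r} j′)
           (rectangle-congruence i i′ j j′ iIj iIj′ i′Ij i′Ij′)
  ... | inj₁ a≡a′ = i≢i′ (points-on-common-block i i′ j a≡a′ iIj i′Ij)
  ... | inj₂ c≡c′ = j≢j′ (blocks-through-common-point i j j′ c≡c′ iIj iIj′)

  point : ∀ {a x} → .(a < k) → .(x < M) → Fin (k * M)
  point = embed {k}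

  block : ∀ {c y} → .(c < r) → .(y < M) → Fin (r * M)
  block = embed {r}

  incident-embedded : ∀ {a x c y} (a<k : a < k) (x<M : x < M) (c<r : c < r) (y<M : y < M) →
                      a * c + x ≡ y → I (point a<k x<M) (block c<r y<M) ≡ true
  incident-embedded {a} {x} {c} {y} a<k x<M c<r y<M eq = incident (point a<k x<M) (block c<r y<M) $ begin
    quot (point a<k x<M) * quot (block c<r y<M) + rem (point a<k x<M)
      ≡⟨ cong₂ _+_ (cong₂ _*_ (quot-embed a<k x<M) (quot-embed c<r y<M)) (rem-embed a<k x<M) ⟩
    a * c + x            ≡⟨ eq ⟩
    y                    ≡⟨ rem-embed c<r y<M ⟨
    rem (block c<r y<M)  ∎

  root : Vertex (k * M) (r * M)
  root = inj₁ (point z<s z<s)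

  open StarReasoning (Adj I) using (step-⟶; step-⟶*) renaming (begin_ to walk_; _∎ to _■)

  -- (0 , x) and (0 , x + 1) are joined through (1 , x), which exists once M > 1 forces k, r ≥ 2.
  first-column-reachable : ∀ {x} (x<M : x < M) → Star (Adj I) root (inj₁ (point z<s x<M))
  first-column-reachable {zero}  _     = ε
  first-column-reachable {suc x} 1+x<M = walk
    root                    ⟶*⟨ first-column-reachable x<M ⟩
    inj₁ (point z<s x<M)    ⟶⟨ incident-embedded z<s x<M z<s x<M refl ⟩
    inj₂ (block z<s x<M)    ⟶⟨ incident-embedded 1<k x<M z<s x<M refl ⟩
    inj₁ (point 1<k x<M)    ⟶⟨ incident-embedded 1<k x<M 1<r 1+x<M refl ⟩
    inj₂ (block 1<r 1+x<M)  ⟶⟨ incident-embedded z<s 1+x<M 1<r 1+x<M refl ⟩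
    inj₁ (point z<s 1+x<M)  ■
    where
    x<M : x < M
    x<M = <-trans (n<1+n x) 1+x<M
    instance
      k′r′≢0 : NonZero (k′ * r′)
      k′r′≢0 = >-nonZero (≤-trans (s≤s z≤n) (s≤s⁻¹ 1+x<M))
    1<k : 1 < k
    1<k = s≤s (>-nonZero⁻¹ k′ {{m*n≢0⇒m≢0 k′}})
    1<r : 1 < r
    1<r = s≤s (>-nonZero⁻¹ r′ {{m*n≢0⇒n≢0 k′}})

  reachable : ∀ v → Star (Adj I) root v
  reachable (inj₁ p) = walk
    root                  ⟶*⟨ first-column-reachable x<M ⟩
    inj₁ (point z<s x<M)  ⟶⟨ incident-embedded z<s x<M z<s x<M refl ⟩
    inj₂ β                ⟶⟨ incident p β p-on-β ⟩
    inj₁ p                ■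
    where
    x<M : rem p < M
    x<M = rem<M p
    β : Fin (r * M)
    β = block z<s x<M
    p-on-β : quot p * quot β + rem p ≡ rem β
    p-on-β = begin
      quot p * quot β + rem p  ≡⟨ cong (λ c → quot p * c + rem p) (quot-embed {r} z<s x<M) ⟩
      quot p * 0 + rem p       ≡⟨ cong (_+ rem p) (*-zeroʳ (quot p)) ⟩
      rem p                    ≡⟨ rem-embed {r} z<s x<M ⟨
      rem β                    ∎
  reachable (inj₂ j) = walk
    root    ⟶*⟨ first-column-reachable y<M ⟩
    inj₁ π  ⟶⟨ incident π j π-on-j ⟩
    inj₂ j  ■
    where
    y<M : rem j < M
    y<M = rem<M j
    π : Fin (k * M)
    π = point z<s y<M
    π-on-j : quot π * quot j + rem π ≡ rem j
    π-on-j = cong₂ (λ a x → a * quot j + x) (quot-embed {k} z<s y<M) (rem-embed {k} z<s y<M)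

  configuration : Configuration (k * M) (r * M) r k
  configuration = record
    { inc       = I
    ; pointReg  = pointReg
    ; blockReg  = blockReg
    ; noC4      = noC4
    ; connected = connected-if-reachable-from I root reachable
    }

[d*m]*[n/d]≡n*m : ∀ d m n .{{_ : NonZero d}} → d ∣ n → d * m * (n / d) ≡ n * m
[d*m]*[n/d]≡n*m d m n d∣n = begin
  d * m * (n / d)    ≡⟨ *-assoc d m (n / d) ⟩
  d * (m * (n / d))  ≡⟨ cong (d *_) (*-comm m (n / d)) ⟩
  d * (n / d * m)    ≡⟨ *-assoc d (n / d) m ⟨
  d * (n / d) * m    ≡⟨ cong (_* m) (m*[n/m]≡n d∣n) ⟩
  n * m              ∎

lemma5 : (r k : ℕ) → .{{_ : NonZero r}} → .{{_ : NonZero k}} → ∃[ d ] (d ≢ 0 × InD r k d)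
lemma5 r@(suc r′) k@(suc k′) = g * M , ≢-nonZero⁻¹ (g * M) , subst₂ (λ v b → Configuration v b r k)
  (sym ([d*m]*[n/d]≡n*m g M k (gcd[m,n]∣n r k)))
  (sym ([d*m]*[n/d]≡n*m g M r (gcd[m,n]∣m r k)))
  configuration
  where
  open Construction k′ r′ using (M; configuration)
  g : ℕ
  g = gcd r k
  instance
    g≢0 : NonZero g
    g≢0 = gcdNZ r k
    gM≢0 : NonZero (g * M)
    gM≢0 = m*n≢0 g M
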